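{- Let $r\geq 4$ and let $M_r$ be the matrix indexed by subsets of $[r]$ with $M_r(S,T)=\binom{|S\cap T|}{2}+\binom{|\overline{S}\cap\overline{T}|}{2}$, $\overline{S}=[r]\setminus S$. For distinct $x,y\in[r]$, define $V\in\mathbb{R}^{\mathcal{P}([r])}$ by $V_T = T(x)-T(y)$, where $T(z)=1$ if $z\in T$ and $T(z)=0$ otherwise. Then $V$ is an eigenvector of $M_r$ with eigenvalue $2^{r-3}(r-2)$.
   Context: $\mathcal{P}([r])$ is the power set of $[r]=\{1,\ldots,r\}$. -}

module Defs where

open import Data.Nat using (ℕ; zero; suc)
open import Data.Integer using (ℤ; +_; _+_; _-_; _*_)
open import Data.Bool using (Bool; true; false)
open import Data.List using (List; []; _∷_; map; _++_; foldr)
open import Data.Vec using (Vec; []; _∷_; lookup)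
open import Data.Fin using (Fin)
open import Data.Fin.Subset using (Subset; _∩_; ∁; ∣_∣)
open import Data.Nat.Combinatorics using (_C_)

allSubsets : (r : ℕ) → List (Subset r)
allSubsets zero = [] ∷ []
allSubsets (suc r) = map (false ∷_) (allSubsets r) ++ map (true ∷_) (allSubsets r)

sumℤ : List ℤ → ℤ
sumℤ = foldr _+_ (+ 0)

M : (r : ℕ) → Subset r → Subset r → ℤ
M r S T = + (∣ S ∩ T ∣ C 2) + + (∣ ∁ S ∩ ∁ T ∣ C 2)

indicator : {r : ℕ} → Subset r → Fin r → ℤ
indicator T z with lookup T z
... | true = + 1
... | false = + 0

V : {r : ℕ} → Fin r → Fin r → Subset r → ℤ
V x y T = indicator T x - indicator T y

mulVec : (r : ℕ) → (Subset r → ℤ) → Subset r → ℤ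
mulVec r v S = sumℤ (map (λ T → M r S T * v T) (allSubsets r))

-- Write P(S,z) (pairSum S z) for the sum over all T of C(|S ∩ T|, 2)·T(z). Replacing T by its
-- complement in the second summand of M_r gives (M_r V)(S) = (P(S,x) − P(S̄,x)) − (P(S,y) − P(S̄,y)).
-- Splitting off the first coordinate of T, induction on r yields 8·P(S,z) = 2^r·(C(|S|,2) + S(z)(|S| − 1));
-- it is stated after multiplying by 8 so that it holds in ℤ for every r. Since S̄(z) = 1 − S(z) and
-- |S| + |S̄| = r, every term of P(S,z) − P(S̄,z) except 2^(r−3)(r − 2)·S(z) is independent of z.
module Submission where

open import Defs
open import Data.Bool using (true; false; not)
open import Data.Bool.Properties using (¬-not; not-involutive)
open import Data.Fin using (Fin; zero; suc)
open import Data.Fin.Subset using (Subset; _∩_; ∁; ∣_∣; ⁅_⁆; _∈_; _∉_)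
open import Data.Fin.Subset.Properties using (x∈⁅x⁆; x≢y⇒x∉⁅y⁆; ∣∁p∣≡n∸∣p∣; ∣p∣≤n)
open import Data.Integer using (ℤ; +_; _+_; _-_; _*_) renaming (_^_ to _^ℤ_)
open import Data.Integer.Properties
  using (pos-+; pos-*; +-identityˡ; +-assoc; +-comm; *-assoc; *-distribʳ-+; *-cancelˡ-≡)
open import Data.Integer.Tactic.RingSolver using (solve-∀)
open import Data.List using (List; []; _∷_; map; _++_)
import Data.List.Properties as List
open import Data.Nat using (ℕ; zero; suc; _≤_; _∸_; _^_; s≤s) renaming (_*_ to _*ℕ_; _+_ to _+ℕ_)
open import Data.Nat.Combinatorics using (_C_; nCk+nC[k+1]≡[n+1]C[k+1]; nC1≡n)
open import Data.Nat.Properties using (m+[n∸m]≡n)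
open import Data.Product using (Σ; _×_; _,_)
open import Data.Vec using ([]; _∷_)
import Data.Vec.Properties as Vec
open import Function using (_∘_)
open import Relation.Binary.PropositionalEquality
  using (_≡_; _≢_; refl; sym; trans; cong; cong₂; module ≡-Reasoning)
open import Relation.Nullary using (contradiction)

open ≡-Reasoning

sumℤ-++ : (xs ys : List ℤ) → sumℤ (xs ++ ys) ≡ sumℤ xs + sumℤ ys
sumℤ-++ []       ys = sym (+-identityˡ (sumℤ ys))
sumℤ-++ (x ∷ xs) ys = trans (cong (_+_ x) (sumℤ-++ xs ys)) (sym (+-assoc x (sumℤ xs) (sumℤ ys)))

module _ {A : Set} where

  sumℤ-map-*ʳ : ∀ (f : A → ℤ) c xs → sumℤ (map (λ a → f a * c) xs) ≡ sumℤ (map f xs) * c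
  sumℤ-map-*ʳ f c []       = refl
  sumℤ-map-*ʳ f c (x ∷ xs) =
    trans (cong (_+_ (f x * c)) (sumℤ-map-*ʳ f c xs)) (sym (*-distribʳ-+ c (f x) _))

  sumℤ-map-+ : ∀ (f g : A → ℤ) xs → sumℤ (map (λ a → f a + g a) xs) ≡ sumℤ (map f xs) + sumℤ (map g xs)
  sumℤ-map-+ f g []       = refl
  sumℤ-map-+ f g (x ∷ xs) =
    trans (cong (_+_ (f x + g x)) (sumℤ-map-+ f g xs)) (interchange (f x) (g x) _ _)
    where
    interchange : ∀ a b c d → a + b + (c + d) ≡ a + c + (b + d)
    interchange = solve-∀

  sumℤ-map-- : ∀ (f g : A → ℤ) xs → sumℤ (map (λ a → f a - g a) xs) ≡ sumℤ (map f xs) - sumℤ (map g xs)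
  sumℤ-map-- f g []       = refl
  sumℤ-map-- f g (x ∷ xs) =
    trans (cong (_+_ (f x - g x)) (sumℤ-map-- f g xs)) (interchange (f x) (g x) _ _)
    where
    interchange : ∀ a b c d → a - b + (c - d) ≡ a + c - (b + d)
    interchange = solve-∀

∑ : (r : ℕ) → (Subset r → ℤ) → ℤ
∑ r f = sumℤ (map f (allSubsets r))

∑-cong : ∀ r {f g : Subset r → ℤ} → (∀ T → f T ≡ g T) → ∑ r f ≡ ∑ r g
∑-cong r f≗g = cong sumℤ (List.map-cong f≗g (allSubsets r))

∑-split : ∀ r (f : Subset (suc r) → ℤ) →
          ∑ (suc r) f ≡ ∑ r (λ T → f (false ∷ T)) + ∑ r (λ T → f (true ∷ T))
∑-split r f = begin
  sumℤ (map f (map (false ∷_) Ts ++ map (true ∷_) Ts))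
    ≡⟨ cong sumℤ (List.map-++ f (map (false ∷_) Ts) _) ⟩
  sumℤ (map f (map (false ∷_) Ts) ++ map f (map (true ∷_) Ts))
    ≡⟨ sumℤ-++ (map f (map (false ∷_) Ts)) _ ⟩
  sumℤ (map f (map (false ∷_) Ts)) + sumℤ (map f (map (true ∷_) Ts))
    ≡⟨ sym (cong₂ _+_ (cong sumℤ (List.map-∘ Ts)) (cong sumℤ (List.map-∘ Ts))) ⟩
  ∑ r (λ T → f (false ∷ T)) + ∑ r (λ T → f (true ∷ T)) ∎
  where Ts = allSubsets r

∑-∁ : ∀ r (f : Subset r → ℤ) → ∑ r (f ∘ ∁) ≡ ∑ r f
∑-∁ zero    f = refl
∑-∁ (suc r) f = begin
  ∑ (suc r) (f ∘ ∁)           ≡⟨ ∑-split r (f ∘ ∁) ⟩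
  ∑ r (f₁ ∘ ∁) + ∑ r (f₀ ∘ ∁) ≡⟨ cong₂ _+_ (∑-∁ r f₁) (∑-∁ r f₀) ⟩
  ∑ r f₁ + ∑ r f₀             ≡⟨ +-comm (∑ r f₁) (∑ r f₀) ⟩
  ∑ r f₀ + ∑ r f₁             ≡⟨ ∑-split r f ⟨
  ∑ (suc r) f                 ∎
  where
  f₀ f₁ : Subset r → ℤ
  f₀ T = f (false ∷ T)
  f₁ T = f (true ∷ T)

∁-involutive : ∀ {r} (T : Subset r) → ∁ (∁ T) ≡ T
∁-involutive T = trans (sym (Vec.map-∘ not not T)) (trans (Vec.map-cong not-involutive T) (Vec.map-id T))

indicator-∁ : ∀ {r} (T : Subset r) z → indicator (∁ T) z ≡ + 1 - indicator T z
indicator-∁ (true  ∷ T) zero    = refl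
indicator-∁ (false ∷ T) zero    = refl
indicator-∁ (_     ∷ T) (suc z) = indicator-∁ T z

indicator-∈ : ∀ {r} {T : Subset r} {z} → z ∈ T → indicator T z ≡ + 1
indicator-∈ z∈T rewrite Vec.[]=⇒lookup z∈T = refl

indicator-∉ : ∀ {r} {T : Subset r} {z} → z ∉ T → indicator T z ≡ + 0
indicator-∉ {T = T} {z} z∉T rewrite ¬-not (z∉T ∘ Vec.lookup⇒[]= z T) = refl

C₂ : ℕ → ℤ
C₂ n = + (n C 2)

C₂-suc : ∀ n → C₂ (suc n) ≡ + n + C₂ n
C₂-suc n = begin
  + (suc n C 2)        ≡⟨ cong +_ (nCk+nC[k+1]≡[n+1]C[k+1] n 1) ⟨
  + (n C 1 +ℕ n C 2)   ≡⟨ cong (λ m → + (m +ℕ n C 2)) (nC1≡n n) ⟩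
  + (n +ℕ n C 2)       ≡⟨ pos-+ n (n C 2) ⟩
  + n + C₂ n           ∎

doubling : ∀ c a p x → c * a ≡ p * x → c * (a + a) ≡ + 2 * p * x
doubling c a p x ca≡px = begin
  c * (a + a)    ≡⟨ twice c a ⟩
  + 2 * (c * a)  ≡⟨ cong (+ 2 *_) ca≡px ⟩
  + 2 * (p * x)  ≡⟨ *-assoc (+ 2) p x ⟨
  + 2 * p * x    ∎
  where
  twice : ∀ c a → c * (a + a) ≡ + 2 * (c * a)
  twice = solve-∀

∑-one : ∀ r → ∑ r (λ _ → + 1) ≡ (+ 2) ^ℤ r
∑-one zero    = refl
∑-one (suc r) = begin
  ∑ (suc r) (λ _ → + 1)             ≡⟨ ∑-split r _ ⟩
  ∑ r (λ _ → + 1) + ∑ r (λ _ → + 1) ≡⟨ cong₂ _+_ (∑-one r) (∑-one r) ⟩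
  (+ 2) ^ℤ r + (+ 2) ^ℤ r           ≡⟨ twice ((+ 2) ^ℤ r) ⟩
  (+ 2) ^ℤ suc r                    ∎
  where
  twice : ∀ p → p + p ≡ + 2 * p
  twice = solve-∀

∑-indicator : ∀ {r} (z : Fin r) → + 2 * ∑ r (λ T → indicator T z) ≡ (+ 2) ^ℤ r
∑-indicator {r} z = begin
  + 2 * I                    ≡⟨ twice I ⟩
  I + I                      ≡⟨ cong (_+_ I) I≡∑1-I ⟩
  I + (∑ r (λ _ → + 1) - I)  ≡⟨ cancel I _ ⟩
  ∑ r (λ _ → + 1)            ≡⟨ ∑-one r ⟩
  (+ 2) ^ℤ r                 ∎
  where
  twice : ∀ a → + 2 * a ≡ a + a
  twice = solve-∀
  cancel : ∀ a b → a + (b - a) ≡ b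
  cancel = solve-∀
  I = ∑ r (λ T → indicator T z)
  I≡∑1-I : I ≡ ∑ r (λ _ → + 1) - I
  I≡∑1-I = begin
    I                                   ≡⟨ ∑-∁ r (λ T → indicator T z) ⟨
    ∑ r (λ T → indicator (∁ T) z)       ≡⟨ ∑-cong r (λ T → indicator-∁ T z) ⟩
    ∑ r (λ T → + 1 - indicator T z)     ≡⟨ sumℤ-map-- (λ _ → + 1) (λ T → indicator T z) (allSubsets r) ⟩
    ∑ r (λ _ → + 1) - I                 ∎

∑-overlap : ∀ {r} (S : Subset r) → + 2 * ∑ r (λ T → + ∣ S ∩ T ∣) ≡ (+ 2) ^ℤ r * + ∣ S ∣
∑-overlap []                  = refl
∑-overlap {suc r} (false ∷ S) =
  trans (cong (+ 2 *_) (∑-split r _))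
        (doubling (+ 2) (∑ r (λ T → + ∣ S ∩ T ∣)) ((+ 2) ^ℤ r) (+ ∣ S ∣) (∑-overlap S))
∑-overlap {suc r} (true  ∷ S) = begin
  + 2 * ∑ (suc r) (λ T → + ∣ (true ∷ S) ∩ T ∣) ≡⟨ cong (+ 2 *_) (∑-split r _) ⟩
  + 2 * (A + ∑ r (λ T → + 1 + N T))           ≡⟨ cong (λ b → + 2 * (A + b)) (sumℤ-map-+ (λ _ → + 1) N Ts) ⟩
  + 2 * (A + (∑ r (λ _ → + 1) + A))           ≡⟨ cong (λ u → + 2 * (A + (u + A))) (∑-one r) ⟩
  + 2 * (A + (R + A))                         ≡⟨ regroup A R ⟩
  + 2 * (+ 2 * A) + + 2 * R                   ≡⟨ cong (λ a → + 2 * a + + 2 * R) (∑-overlap S) ⟩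
  + 2 * (R * k) + + 2 * R                     ≡⟨ collect R k ⟩
  + 2 * R * (+ 1 + k)                         ∎
  where
  N = λ T → + ∣ S ∩ T ∣
  Ts = allSubsets r
  A = ∑ r N
  R = (+ 2) ^ℤ r
  k = + ∣ S ∣
  regroup : ∀ a p → + 2 * (a + (p + a)) ≡ + 2 * (+ 2 * a) + + 2 * p
  regroup = solve-∀
  collect : ∀ p k → + 2 * (p * k) + + 2 * p ≡ + 2 * p * (+ 1 + k)
  collect = solve-∀

∑-C₂-overlap : ∀ {r} (S : Subset r) → + 4 * ∑ r (λ T → C₂ ∣ S ∩ T ∣) ≡ (+ 2) ^ℤ r * C₂ ∣ S ∣
∑-C₂-overlap []                  = refl
∑-C₂-overlap {suc r} (false ∷ S) =
  trans (cong (+ 4 *_) (∑-split r _))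
        (doubling (+ 4) (∑ r (λ T → C₂ ∣ S ∩ T ∣)) ((+ 2) ^ℤ r) (C₂ ∣ S ∣) (∑-C₂-overlap S))
∑-C₂-overlap {suc r} (true  ∷ S) = begin
  + 4 * ∑ (suc r) (λ T → C₂ ∣ (true ∷ S) ∩ T ∣)
    ≡⟨ cong (+ 4 *_) (∑-split r _) ⟩
  + 4 * (A + ∑ r (λ T → C₂ (suc ∣ S ∩ T ∣)))
    ≡⟨ cong (λ b → + 4 * (A + b)) (trans (∑-cong r (λ T → C₂-suc ∣ S ∩ T ∣)) (sumℤ-map-+ N P Ts)) ⟩
  + 4 * (A + (B + A))                     ≡⟨ regroup A B ⟩
  + 2 * (+ 4 * A) + + 2 * (+ 2 * B)       ≡⟨ cong₂ (λ a b → + 2 * a + + 2 * b) (∑-C₂-overlap S) (∑-overlap S) ⟩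
  + 2 * (R * c) + + 2 * (R * k)           ≡⟨ collect R k c ⟩
  + 2 * R * (k + c)                       ≡⟨ cong (+ 2 * R *_) (C₂-suc ∣ S ∣) ⟨
  + 2 * R * C₂ (suc ∣ S ∣)                 ∎
  where
  N = λ T → + ∣ S ∩ T ∣
  P = λ T → C₂ ∣ S ∩ T ∣
  Ts = allSubsets r
  A = ∑ r P
  B = ∑ r N
  R = (+ 2) ^ℤ r
  k = + ∣ S ∣
  c = C₂ ∣ S ∣
  regroup : ∀ a b → + 4 * (a + (b + a)) ≡ + 2 * (+ 4 * a) + + 2 * (+ 2 * b)
  regroup = solve-∀
  collect : ∀ p k c → + 2 * (p * c) + + 2 * (p * k) ≡ + 2 * p * (k + c)
  collect = solve-∀

∑-overlap-indicator : ∀ {r} (S : Subset r) z →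
  + 4 * ∑ r (λ T → + ∣ S ∩ T ∣ * indicator T z) ≡ (+ 2) ^ℤ r * (+ ∣ S ∣ + indicator S z)
∑-overlap-indicator {suc r} (false ∷ S) zero = begin
  + 4 * ∑ (suc r) (λ T → + ∣ (false ∷ S) ∩ T ∣ * indicator T zero)
    ≡⟨ cong (+ 4 *_) (trans (∑-split r _) (cong₂ _+_ (sumℤ-map-*ʳ N (+ 0) Ts) (sumℤ-map-*ʳ N (+ 1) Ts))) ⟩
  + 4 * (A * + 0 + A * + 1)  ≡⟨ regroup A ⟩
  + 2 * (+ 2 * A)            ≡⟨ cong (+ 2 *_) (∑-overlap S) ⟩
  + 2 * (R * k)              ≡⟨ collect R k ⟩
  + 2 * R * (k + + 0)        ∎
  where
  N = λ T → + ∣ S ∩ T ∣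
  Ts = allSubsets r
  A = ∑ r N
  R = (+ 2) ^ℤ r
  k = + ∣ S ∣
  regroup : ∀ a → + 4 * (a * + 0 + a * + 1) ≡ + 2 * (+ 2 * a)
  regroup = solve-∀
  collect : ∀ p k → + 2 * (p * k) ≡ + 2 * p * (k + + 0)
  collect = solve-∀
∑-overlap-indicator {suc r} (true ∷ S) zero = begin
  + 4 * ∑ (suc r) (λ T → + ∣ (true ∷ S) ∩ T ∣ * indicator T zero)
    ≡⟨ cong (+ 4 *_) (trans (∑-split r _) (cong₂ _+_ (sumℤ-map-*ʳ N (+ 0) Ts) (sumℤ-map-*ʳ N₁ (+ 1) Ts))) ⟩
  + 4 * (A * + 0 + ∑ r N₁ * + 1)
    ≡⟨ cong (λ b → + 4 * (A * + 0 + b * + 1)) (trans (sumℤ-map-+ (λ _ → + 1) N Ts) (cong (_+ A) (∑-one r))) ⟩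
  + 4 * (A * + 0 + (R + A) * + 1)  ≡⟨ regroup A R ⟩
  + 4 * R + + 2 * (+ 2 * A)        ≡⟨ cong (λ a → + 4 * R + + 2 * a) (∑-overlap S) ⟩
  + 4 * R + + 2 * (R * k)          ≡⟨ collect R k ⟩
  + 2 * R * (+ 1 + k + + 1)        ∎
  where
  N = λ T → + ∣ S ∩ T ∣
  N₁ = λ T → + 1 + N T
  Ts = allSubsets r
  A = ∑ r N
  R = (+ 2) ^ℤ r
  k = + ∣ S ∣
  regroup : ∀ a p → + 4 * (a * + 0 + (p + a) * + 1) ≡ + 4 * p + + 2 * (+ 2 * a)
  regroup = solve-∀
  collect : ∀ p k → + 4 * p + + 2 * (p * k) ≡ + 2 * p * (+ 1 + k + + 1)
  collect = solve-∀
∑-overlap-indicator {suc r} (false ∷ S) (suc z) =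
  trans (cong (+ 4 *_) (∑-split r _))
        (doubling (+ 4) (∑ r (λ T → + ∣ S ∩ T ∣ * indicator T z)) ((+ 2) ^ℤ r) (+ ∣ S ∣ + indicator S z)
                  (∑-overlap-indicator S z))
∑-overlap-indicator {suc r} (true ∷ S) (suc z) = begin
  + 4 * ∑ (suc r) (λ T → + ∣ (true ∷ S) ∩ T ∣ * indicator T (suc z))
    ≡⟨ cong (+ 4 *_) (∑-split r _) ⟩
  + 4 * (A + ∑ r (λ T → (+ 1 + N T) * I T))
    ≡⟨ cong (λ b → + 4 * (A + b)) (trans (∑-cong r (λ T → distrib (N T) (I T))) (sumℤ-map-+ I NI Ts)) ⟩
  + 4 * (A + (∑ r I + A))                ≡⟨ regroup A (∑ r I) ⟩
  + 2 * (+ 4 * A) + + 2 * (+ 2 * ∑ r I)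
    ≡⟨ cong₂ (λ a b → + 2 * a + + 2 * b) (∑-overlap-indicator S z) (∑-indicator z) ⟩
  + 2 * (R * (k + s)) + + 2 * R          ≡⟨ collect R k s ⟩
  + 2 * R * (+ 1 + k + s)                ∎
  where
  N = λ T → + ∣ S ∩ T ∣
  I = λ T → indicator T z
  NI = λ T → N T * I T
  Ts = allSubsets r
  A = ∑ r NI
  R = (+ 2) ^ℤ r
  k = + ∣ S ∣
  s = indicator S z
  distrib : ∀ n i → (+ 1 + n) * i ≡ i + n * i
  distrib = solve-∀
  regroup : ∀ a w → + 4 * (a + (w + a)) ≡ + 2 * (+ 4 * a) + + 2 * (+ 2 * w)
  regroup = solve-∀
  collect : ∀ p k s → + 2 * (p * (k + s)) + + 2 * p ≡ + 2 * p * (+ 1 + k + s)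
  collect = solve-∀

pairSum : ∀ {r} → Subset r → Fin r → ℤ
pairSum {r} S z = ∑ r (λ T → C₂ ∣ S ∩ T ∣ * indicator T z)

pairSum-closed-form : ∀ {r} (S : Subset r) z →
  + 8 * pairSum S z ≡ (+ 2) ^ℤ r * (C₂ ∣ S ∣ + indicator S z * (+ ∣ S ∣ - + 1))
pairSum-closed-form {suc r} (false ∷ S) zero = begin
  + 8 * pairSum (false ∷ S) zero
    ≡⟨ cong (+ 8 *_) (trans (∑-split r _) (cong₂ _+_ (sumℤ-map-*ʳ P (+ 0) Ts) (sumℤ-map-*ʳ P (+ 1) Ts))) ⟩
  + 8 * (A * + 0 + A * + 1)       ≡⟨ regroup A ⟩
  + 2 * (+ 4 * A)                 ≡⟨ cong (+ 2 *_) (∑-C₂-overlap S) ⟩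
  + 2 * (R * c)                   ≡⟨ collect R c k ⟩
  + 2 * R * (c + + 0 * (k - + 1)) ∎
  where
  P = λ T → C₂ ∣ S ∩ T ∣
  Ts = allSubsets r
  A = ∑ r P
  R = (+ 2) ^ℤ r
  k = + ∣ S ∣
  c = C₂ ∣ S ∣
  regroup : ∀ a → + 8 * (a * + 0 + a * + 1) ≡ + 2 * (+ 4 * a)
  regroup = solve-∀
  collect : ∀ p c k → + 2 * (p * c) ≡ + 2 * p * (c + + 0 * (k - + 1))
  collect = solve-∀
pairSum-closed-form {suc r} (true ∷ S) zero = begin
  + 8 * pairSum (true ∷ S) zero
    ≡⟨ cong (+ 8 *_) (trans (∑-split r _) (cong₂ _+_ (sumℤ-map-*ʳ P (+ 0) Ts) (sumℤ-map-*ʳ P₁ (+ 1) Ts))) ⟩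
  + 8 * (A * + 0 + ∑ r P₁ * + 1)
    ≡⟨ cong (λ b → + 8 * (A * + 0 + b * + 1))
            (trans (∑-cong r (λ T → C₂-suc ∣ S ∩ T ∣)) (sumℤ-map-+ N P Ts)) ⟩
  + 8 * (A * + 0 + (B + A) * + 1)     ≡⟨ regroup A B ⟩
  + 2 * (+ 4 * A) + + 4 * (+ 2 * B)   ≡⟨ cong₂ (λ a b → + 2 * a + + 4 * b) (∑-C₂-overlap S) (∑-overlap S) ⟩
  + 2 * (R * c) + + 4 * (R * k)       ≡⟨ collect R k c ⟩
  + 2 * R * ((k + c) + + 1 * k)       ≡⟨ cong (λ d → + 2 * R * (d + + 1 * k)) (C₂-suc ∣ S ∣) ⟨
  + 2 * R * (C₂ (suc ∣ S ∣) + + 1 * k) ∎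
  where
  N = λ T → + ∣ S ∩ T ∣
  P = λ T → C₂ ∣ S ∩ T ∣
  P₁ = λ T → C₂ (suc ∣ S ∩ T ∣)
  Ts = allSubsets r
  A = ∑ r P
  B = ∑ r N
  R = (+ 2) ^ℤ r
  k = + ∣ S ∣
  c = C₂ ∣ S ∣
  regroup : ∀ a b → + 8 * (a * + 0 + (b + a) * + 1) ≡ + 2 * (+ 4 * a) + + 4 * (+ 2 * b)
  regroup = solve-∀
  collect : ∀ p k c → + 2 * (p * c) + + 4 * (p * k) ≡ + 2 * p * ((k + c) + + 1 * k)
  collect = solve-∀
pairSum-closed-form {suc r} (false ∷ S) (suc z) =
  trans (cong (+ 8 *_) (∑-split r _))
        (doubling (+ 8) (pairSum S z) ((+ 2) ^ℤ r) (C₂ ∣ S ∣ + indicator S z * (+ ∣ S ∣ - + 1))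
                  (pairSum-closed-form S z))
pairSum-closed-form {suc r} (true ∷ S) (suc z) = begin
  + 8 * pairSum (true ∷ S) (suc z)
    ≡⟨ cong (+ 8 *_) (∑-split r _) ⟩
  + 8 * (A + ∑ r (λ T → C₂ (suc ∣ S ∩ T ∣) * I T))
    ≡⟨ cong (λ b → + 8 * (A + b)) (trans (∑-cong r split-C₂-suc) (sumℤ-map-+ NI PI Ts)) ⟩
  + 8 * (A + (B + A))                         ≡⟨ regroup A B ⟩
  + 2 * (+ 8 * A) + + 2 * (+ 4 * B)
    ≡⟨ cong₂ (λ a b → + 2 * a + + 2 * b) (pairSum-closed-form S z) (∑-overlap-indicator S z) ⟩
  + 2 * (R * (c + s * (k - + 1))) + + 2 * (R * (k + s))
    ≡⟨ collect R k c s ⟩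
  + 2 * R * ((k + c) + s * k)                 ≡⟨ cong (λ d → + 2 * R * (d + s * k)) (C₂-suc ∣ S ∣) ⟨
  + 2 * R * (C₂ (suc ∣ S ∣) + s * k)           ∎
  where
  N = λ T → + ∣ S ∩ T ∣
  P = λ T → C₂ ∣ S ∩ T ∣
  I = λ T → indicator T z
  NI = λ T → N T * I T
  PI = λ T → P T * I T
  Ts = allSubsets r
  A = pairSum S z
  B = ∑ r NI
  R = (+ 2) ^ℤ r
  k = + ∣ S ∣
  c = C₂ ∣ S ∣
  s = indicator S z
  split-C₂-suc : ∀ T → C₂ (suc ∣ S ∩ T ∣) * I T ≡ NI T + PI T
  split-C₂-suc T = trans (cong (_* I T) (C₂-suc ∣ S ∩ T ∣)) (*-distribʳ-+ (I T) (N T) (P T))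
  regroup : ∀ a b → + 8 * (a + (b + a)) ≡ + 2 * (+ 8 * a) + + 2 * (+ 4 * b)
  regroup = solve-∀
  collect : ∀ p k c s → + 2 * (p * (c + s * (k - + 1))) + + 2 * (p * (k + s)) ≡ + 2 * p * ((k + c) + s * k)
  collect = solve-∀

∑-C₂-overlap-∁-indicator : ∀ {r} (S : Subset r) z →
  ∑ r (λ T → C₂ ∣ ∁ S ∩ ∁ T ∣ * indicator T z)
    ≡ ∑ r (λ T → C₂ ∣ ∁ S ∩ T ∣) - pairSum (∁ S) z
∑-C₂-overlap-∁-indicator {r} S z = begin
  ∑ r (λ T → P (∁ T) * indicator T z)
    ≡⟨ ∑-cong r (λ T → cong (λ U → P (∁ T) * indicator U z) (∁-involutive T)) ⟨
  ∑ r (λ T → P (∁ T) * indicator (∁ (∁ T)) z)   ≡⟨ ∑-∁ r (λ T → P T * indicator (∁ T) z) ⟩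
  ∑ r (λ T → P T * indicator (∁ T) z)           ≡⟨ ∑-cong r (λ T → cong (P T *_) (indicator-∁ T z)) ⟩
  ∑ r (λ T → P T * (+ 1 - indicator T z))       ≡⟨ ∑-cong r (λ T → distrib (P T) (indicator T z)) ⟩
  ∑ r (λ T → P T - P T * indicator T z)         ≡⟨ sumℤ-map-- P (λ T → P T * indicator T z) (allSubsets r) ⟩
  ∑ r P - pairSum (∁ S) z                       ∎
  where
  P = λ T → C₂ ∣ ∁ S ∩ T ∣
  distrib : ∀ p i → p * (+ 1 - i) ≡ p - p * i
  distrib = solve-∀

∑-M-indicator : ∀ {r} (S : Subset r) z →
  ∑ r (λ T → M r S T * indicator T z)
    ≡ pairSum S z + (∑ r (λ T → C₂ ∣ ∁ S ∩ T ∣) - pairSum (∁ S) z)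
∑-M-indicator {r} S z = begin
  ∑ r (λ T → M r S T * indicator T z)
    ≡⟨ ∑-cong r (λ T → *-distribʳ-+ (indicator T z) (C₂ ∣ S ∩ T ∣) (C₂ ∣ ∁ S ∩ ∁ T ∣)) ⟩
  ∑ r (λ T → PI T + P̄I T)
    ≡⟨ sumℤ-map-+ PI P̄I (allSubsets r) ⟩
  pairSum S z + ∑ r P̄I
    ≡⟨ cong (_+_ (pairSum S z)) (∑-C₂-overlap-∁-indicator S z) ⟩
  pairSum S z + (∑ r (λ T → C₂ ∣ ∁ S ∩ T ∣) - pairSum (∁ S) z) ∎
  where
  PI P̄I : Subset r → ℤ
  PI T = C₂ ∣ S ∩ T ∣ * indicator T z
  P̄I T = C₂ ∣ ∁ S ∩ ∁ T ∣ * indicator T z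

mulVec-V : ∀ {r} (x y : Fin r) S →
  mulVec r (V x y) S ≡ (pairSum S x - pairSum (∁ S) x) - (pairSum S y - pairSum (∁ S) y)
mulVec-V {r} x y S = begin
  ∑ r (λ T → M r S T * (indicator T x - indicator T y))
    ≡⟨ ∑-cong r (λ T → distrib (M r S T) (indicator T x) (indicator T y)) ⟩
  ∑ r (λ T → M r S T * indicator T x - M r S T * indicator T y)
    ≡⟨ sumℤ-map-- (λ T → M r S T * indicator T x) (λ T → M r S T * indicator T y) (allSubsets r) ⟩
  ∑ r (λ T → M r S T * indicator T x) - ∑ r (λ T → M r S T * indicator T y)
    ≡⟨ cong₂ _-_ (∑-M-indicator S x) (∑-M-indicator S y) ⟩
  (pairSum S x + (U - pairSum (∁ S) x)) - (pairSum S y + (U - pairSum (∁ S) y))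
    ≡⟨ cancel (pairSum S x) (pairSum (∁ S) x) (pairSum S y) (pairSum (∁ S) y) U ⟩
  (pairSum S x - pairSum (∁ S) x) - (pairSum S y - pairSum (∁ S) y) ∎
  where
  U = ∑ r (λ T → C₂ ∣ ∁ S ∩ T ∣)
  distrib : ∀ m a b → m * (a - b) ≡ m * a - m * b
  distrib = solve-∀
  cancel : ∀ a a' b b' u → (a + (u - a')) - (b + (u - b')) ≡ (a - a') - (b - b')
  cancel = solve-∀

∣p∣+∣∁p∣≡n : ∀ {r} (S : Subset r) → + ∣ S ∣ + + ∣ ∁ S ∣ ≡ + r
∣p∣+∣∁p∣≡n S =
  cong +_ (trans (cong (∣ S ∣ +ℕ_) (∣∁p∣≡n∸∣p∣ S)) (m+[n∸m]≡n (∣p∣≤n S)))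

8*mulVec-V : ∀ r (x y : Fin r) S → + 8 * mulVec r (V x y) S ≡ (+ 2) ^ℤ r * (+ r - + 2) * V x y S
8*mulVec-V r x y S = begin
  + 8 * mulVec r (V x y) S
    ≡⟨ cong (+ 8 *_) (mulVec-V x y S) ⟩
  + 8 * ((pairSum S x - pairSum (∁ S) x) - (pairSum S y - pairSum (∁ S) y))
    ≡⟨ spread (pairSum S x - pairSum (∁ S) x) (pairSum S y - pairSum (∁ S) y) ⟩
  + 8 * (pairSum S x - pairSum (∁ S) x) - + 8 * (pairSum S y - pairSum (∁ S) y)
    ≡⟨ cong₂ _-_ (difference x) (difference y) ⟩
  R * (Q + indicator S x * (+ r - + 2)) - R * (Q + indicator S y * (+ r - + 2))
    ≡⟨ collect R Q (+ r - + 2) (indicator S x) (indicator S y) ⟩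
  R * (+ r - + 2) * V x y S ∎
  where
  R = (+ 2) ^ℤ r
  k = + ∣ S ∣
  k̄ = + ∣ ∁ S ∣
  Q = C₂ ∣ S ∣ - C₂ ∣ ∁ S ∣ - (k̄ - + 1)
  spread : ∀ a b → + 8 * (a - b) ≡ + 8 * a - + 8 * b
  spread = solve-∀
  collect : ∀ p q n a b → p * (q + a * n) - p * (q + b * n) ≡ p * n * (a - b)
  collect = solve-∀
  rearrange : ∀ p c c̄ k k̄ s → p * (c + s * (k - + 1)) - p * (c̄ + (+ 1 - s) * (k̄ - + 1))
                              ≡ p * ((c - c̄ - (k̄ - + 1)) + s * ((k + k̄) - + 2))
  rearrange = solve-∀
  difference : ∀ z → + 8 * (pairSum S z - pairSum (∁ S) z) ≡ R * (Q + indicator S z * (+ r - + 2))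
  difference z = begin
    + 8 * (pairSum S z - pairSum (∁ S) z)
      ≡⟨ spread (pairSum S z) (pairSum (∁ S) z) ⟩
    + 8 * pairSum S z - + 8 * pairSum (∁ S) z
      ≡⟨ cong₂ _-_ (pairSum-closed-form S z) (pairSum-closed-form (∁ S) z) ⟩
    R * (C₂ ∣ S ∣ + s * (k - + 1)) - R * (C₂ ∣ ∁ S ∣ + indicator (∁ S) z * (k̄ - + 1))
      ≡⟨ cong (λ s̄ → R * (C₂ ∣ S ∣ + s * (k - + 1)) - R * (C₂ ∣ ∁ S ∣ + s̄ * (k̄ - + 1)))
              (indicator-∁ S z) ⟩
    R * (C₂ ∣ S ∣ + s * (k - + 1)) - R * (C₂ ∣ ∁ S ∣ + (+ 1 - s) * (k̄ - + 1))
      ≡⟨ rearrange R (C₂ ∣ S ∣) (C₂ ∣ ∁ S ∣) k k̄ s ⟩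
    R * (Q + s * ((k + k̄) - + 2))
      ≡⟨ cong (λ n → R * (Q + s * (n - + 2))) (∣p∣+∣∁p∣≡n S) ⟩
    R * (Q + s * (+ r - + 2)) ∎
    where s = indicator S z

pos-^ : ∀ m n → + (m ^ n) ≡ (+ m) ^ℤ n
pos-^ m zero    = refl
pos-^ m (suc n) = trans (pos-* m (m ^ n)) (cong (+ m *_) (pos-^ m n))

eigenvalue : ∀ m → (+ 2) ^ℤ (3 +ℕ m) * (+ (3 +ℕ m) - + 2) ≡ + 8 * + (2 ^ m *ℕ suc m)
eigenvalue m = begin
  (+ 2) ^ℤ (3 +ℕ m) * (+ (3 +ℕ m) - + 2) ≡⟨ regroup ((+ 2) ^ℤ m) (+ m) ⟩
  + 8 * ((+ 2) ^ℤ m * + suc m)           ≡⟨ cong (λ p → + 8 * (p * + suc m)) (pos-^ 2 m) ⟨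
  + 8 * (+ (2 ^ m) * + suc m)            ≡⟨ cong (+ 8 *_) (pos-* (2 ^ m) (suc m)) ⟨
  + 8 * + (2 ^ m *ℕ suc m)               ∎
  where
  regroup : ∀ p n → + 2 * (+ 2 * (+ 2 * p)) * (+ 3 + n - + 2) ≡ + 8 * (p * (+ 1 + n))
  regroup = solve-∀

V-⁅x⁆ : ∀ {r} {x y : Fin r} → x ≢ y → V x y ⁅ x ⁆ ≡ + 1
V-⁅x⁆ {x = x} x≢y = cong₂ _-_ (indicator-∈ (x∈⁅x⁆ x)) (indicator-∉ (x≢y⇒x∉⁅y⁆ (x≢y ∘ sym)))

proposition4 : (r : ℕ) → 4 ≤ r → (x y : Fin r) → x ≢ y →
    ((S : Subset r) → mulVec r (V x y) S ≡ + (2 ^ (r ∸ 3) *ℕ (r ∸ 2)) * V x y S)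
    × Σ (Subset r) (λ T → V x y T ≢ + 0)
proposition4 r@(suc (suc (suc m))) (s≤s (s≤s (s≤s _))) x y x≢y = eigenvector , ⁅ x ⁆ , V⁅x⁆≢0
  where
  eigenvector : (S : Subset r) → mulVec r (V x y) S ≡ + (2 ^ m *ℕ suc m) * V x y S
  eigenvector S = *-cancelˡ-≡ (+ 8) _ _ (begin
    + 8 * mulVec r (V x y) S                 ≡⟨ 8*mulVec-V r x y S ⟩
    (+ 2) ^ℤ r * (+ r - + 2) * V x y S        ≡⟨ cong (_* V x y S) (eigenvalue m) ⟩
    + 8 * + (2 ^ m *ℕ suc m) * V x y S        ≡⟨ *-assoc (+ 8) (+ (2 ^ m *ℕ suc m)) (V x y S) ⟩
    + 8 * (+ (2 ^ m *ℕ suc m) * V x y S)      ∎)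
  V⁅x⁆≢0 : V x y ⁅ x ⁆ ≢ + 0
  V⁅x⁆≢0 eq = contradiction (trans (sym eq) (V-⁅x⁆ x≢y)) λ ()
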